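{- Let $n,k\ge1$, fix a whirling orbit board of $\mathcal{F}_k({\sf C}_n)$ decomposed into whorms, and let $\alpha=\alpha(f)$ for any $f$ in the orbit. If $\xi_1,\dots,\xi_{\alpha+2}$ are consecutive whorms ($\xi_{i+1}$ in front of $\xi_i$), then $t(\xi_1)=t(\xi_{\alpha+2})$.
   Context: ${\sf C}_n=\{b_1,\dots,b_n,\widehat0\}$ with $\widehat0<b_i$ and no other relations. $\mathcal{F}_k({\sf C}_n)$ is the set of $f:{\sf C}_n\to\{0,\dots,k\}$ with $f(b_i)\le f(\widehat0)$. The whirl $w_x$ repeatedly adds $1$ mod $k+1$ to $f(x)$ until the result lies in $\mathcal{F}_k({\sf C}_n)$; $w=w_{\widehat0}\circ w_{b_n}\circ\cdots\circ w_{b_1}$. $\alpha(f)=\#\{f(b_j):j\in[n]\}$. Orbit board of a $w$-orbit of size $N$: rows $f_0,\dots,f_{N-1}$ with $f_{t+1}=w(f_t)$, indices mod $N$. Whirl elements: pairs $(x,f_t)$. $(y,f_s)$ is whirl-successive to $(x,f_t)$ if (i) $y=x$, $s=t+1$, $f_s(x)=f_t(x)+1$ (as integers), or (ii) $x$ covers $y$, $s=t$, $f_t(x)=f_t(y)$. Whorms are the classes of the equivalence relation generated by whirl-successiveness. $t(\xi)=1+\min\{f_t(\widehat0):(\widehat0,f_t)\in\xi\}$. $\xi'$ is in front of $\xi$ if there is $t$ with $(\widehat0,f_t)\in\xi$, $f_t(\widehat0)=k$, $(\widehat0,f_{t+1})\in\xi'$. -}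

module Defs where

open import Data.Nat using (ℕ; zero; suc; _+_; NonZero) renaming (_≤_ to _≤ℕ_)
open import Data.Nat.DivMod using (_%_; m%n<n)
open import Data.Fin using (Fin; toℕ; fromℕ<; _≤_)
open import Data.Fin.Properties using (all?; any?; _≤?_; _≟_)
open import Data.List using (List; length; filter; foldl; allFin)
open import Data.Product using (_×_; _,_; ∃)
open import Data.Sum using (_⊎_)
open import Relation.Nullary using (Dec; yes; no)
open import Relation.Binary.PropositionalEquality using (_≡_; _≗_)
open import Relation.Binary.Construct.Closure.Equivalence using (EqClosure)
open import Relation.Nullary using (¬_)

-- The poset C_n = {b_1,...,b_n, 0̂}; b i (i : Fin n) is b_{i+1}.
data Elt (n : ℕ) : Set where
  bot : Elt n
  b   : Fin n → Elt n

data _⋗_ {n : ℕ} : Elt n → Elt n → Set where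
  cov : ∀ i → b i ⋗ bot

Lab : ℕ → ℕ → Set
Lab n k = Elt n → Fin (suc k)

InF : ∀ {n k} → Lab n k → Set
InF {n} f = ∀ (i : Fin n) → f (b i) ≤ f bot

inF? : ∀ {n k} (f : Lab n k) → Dec (InF f)
inF? f = all? (λ i → f (b i) ≤? f bot)

set : ∀ {n k} → Lab n k → Elt n → Fin (suc k) → Lab n k
set f bot   v bot   = v
set f bot   v (b j) = f (b j)
set f (b i) v bot   = f bot
set f (b i) v (b j) with i ≟ j
... | yes _ = v
... | no  _ = f (b j)

incr : ∀ {k} → Fin (suc k) → Fin (suc k)
incr {k} i = fromℕ< (m%n<n (suc (toℕ i)) (suc k))

whirlAux : ∀ {n k} → ℕ → Elt n → Lab n k → Lab n k
whirlAux zero    x f = f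
whirlAux (suc m) x f with inF? (set f x (incr (f x)))
... | yes _ = set f x (incr (f x))
... | no  _ = whirlAux m x (set f x (incr (f x)))

-- The toggle-like whirl w_x (k+1 steps always suffice on F_k).
whirlAt : ∀ {n k} → Elt n → Lab n k → Lab n k
whirlAt {k = k} x f = whirlAux (suc k) x f

whirl : ∀ {n k} → Lab n k → Lab n k
whirl {n} f = whirlAt bot (foldl (λ g i → whirlAt (b i) g) f (allFin n))

wpow : ∀ {n k} → ℕ → Lab n k → Lab n k
wpow zero    f = f
wpow (suc t) f = whirl (wpow t f)

IsOrbitSize : ∀ {n k} → Lab n k → ℕ → Set
IsOrbitSize f N = (wpow N f ≗ f) × (∀ m → 1 ≤ℕ m → suc m ≤ℕ N → ¬ (wpow m f ≗ f))

α : ∀ {n k} → Lab n k → ℕ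
α {n} {k} f = length (filter (λ v → any? (λ j → f (b j) ≟ v)) (allFin (suc k)))

module Board {n k : ℕ} (f₀ : Lab n k) (N : ℕ) .{{_ : NonZero N}} where

  row : Fin N → Lab n k
  row t = wpow (toℕ t) f₀

  nextT : Fin N → Fin N
  nextT t = fromℕ< (m%n<n (suc (toℕ t)) N)

  WE : Set
  WE = Elt n × Fin N

  WSucc : WE → WE → Set
  WSucc (x , t) (y , s) =
      (y ≡ x × s ≡ nextT t × toℕ (row s x) ≡ suc (toℕ (row t x)))
    ⊎ (x ⋗ y × s ≡ t × row t x ≡ row t y)

  -- same whorm: equivalence relation generated by whirl-successiveness.
  -- A whorm is represented by any of its elements.
  SameWhorm : WE → WE → Set
  SameWhorm = EqClosure WSucc

  InFront : WE → WE → Set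
  InFront e e' = ∃ λ (t : Fin N) →
    SameWhorm e (bot , t) × toℕ (row t bot) ≡ k × SameWhorm e' (bot , nextT t)

  IsT : WE → ℕ → Set
  IsT e τ = (∃ λ (t : Fin N) → SameWhorm e (bot , t) × suc (toℕ (row t bot)) ≡ τ)
          × (∀ (t : Fin N) → SameWhorm e (bot , t) → τ ≤ℕ suc (toℕ (row t bot)))

{-# OPTIONS --safe #-}
module Submission where

-- Write c = f(0̂). Call the following positions of ℤ/(k+2) occupied: c itself, the values of the
-- leaves b_i lying below c, and k+1 when some leaf equals c. There are α(f)+1 of them, and one
-- whirl rotates them by +1. Hence c is (k+2)-periodic along the orbit, and c = k holds in exactly
-- α+1 of any k+2 consecutive rows.
-- The row where the label of x, rising by one per row, would reach k (its summit) is constant on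
-- whorms and, for elements (0̂, f_t), determines the whorm. If ξ′ is in front of ξ, the summit of ξ′
-- is the first peak after that of ξ; so the summits of ξ_1 and ξ_{α+2} lie k+2 rows apart, and
-- moving the 0̂-elements of either whorm by a multiple of k+2 rows, which preserves c, lands in
-- the other one.

open import Defs
open import Data.Nat using (ℕ; zero; suc; _+_; _≤_; NonZero)
open import Data.Fin using (Fin; inject₁; fromℕ)
open import Relation.Binary.PropositionalEquality using (_≡_)

open import Data.Bool.Base using (Bool; true; false)
open import Data.Fin.Base as F using (toℕ)
open import Data.Fin.Properties as F using (toℕ-injective; toℕ-fromℕ<; toℕ<n; ¬∀⟶∃¬)
open import Data.List.Base using (List; []; _∷_; foldl; allFin; filter; length; tabulate)
open import Data.List.Membership.Propositional using (_∈_; _∉_)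
open import Data.List.Membership.Propositional.Properties using (∈-allFin)
open import Data.List.Relation.Unary.All as All using (All)
open import Data.List.Relation.Unary.AllPairs using ([]; _∷_)
open import Data.List.Relation.Unary.Any using (here; there)
open import Data.List.Relation.Unary.Unique.Propositional using (Unique)
open import Data.List.Relation.Unary.Unique.Propositional.Properties using (allFin⁺)
open import Data.Nat.Base using (_<_; _∸_; _*_; pred; z≤n; s≤s; z<s; s<s)
open import Data.Nat.Divisibility using (_∣_; divides; ∣-refl; n∣m*n)
open import Data.Nat.DivMod using (_%_; m<n⇒m%n≡m; n%n≡0; %-distribˡ-+; m%n%n≡m%n; [m+n]%n≡m%n)
open import Data.Nat.GeneralisedArithmetic using (iterate)
open import Data.Nat.Properties
open import Algebra.Properties.CommutativeSemigroup +-commutativeSemigroup using (x∙yz≈y∙xz)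
open import Data.Product using (_×_; _,_; proj₁; proj₂; ∃)
open import Data.Sum using (_⊎_; inj₁; inj₂)
open import Function.Base using (_∘_)
open import Function.Bundles using (_⇔_; mk⇔; Equivalence)
import Function.Properties.Equivalence as ⇔
open import Relation.Binary.Construct.Closure.ReflexiveTransitive using (ε; _◅_)
open import Relation.Binary.Construct.Closure.Symmetric using (fwd)
import Relation.Binary.Construct.Closure.Equivalence as EqClosure
open import Relation.Binary.PropositionalEquality
  using (_≢_; _≗_; refl; sym; trans; cong; cong₂; subst; subst₂; isEquivalence; module ≡-Reasoning)
open import Relation.Nullary using (¬_; yes; no; does; contradiction)
open import Relation.Nullary.Decidable using (does-⇔; dec-true; dec-false; _⊎-dec_; _×-dec_)
open import Relation.Unary using (Decidable)

-- Iterates and window counts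

module _ {A : Set} (f : A → A) where

  iterate-+ : ∀ x m n → iterate f x (m + n) ≡ iterate f (iterate f x m) n
  iterate-+ x zero    n = refl
  iterate-+ x (suc m) n = iterate-+ (f x) m n

  iterate-suc : ∀ x m → iterate f x (suc m) ≡ f (iterate f x m)
  iterate-suc x zero    = refl
  iterate-suc x (suc m) = iterate-suc (f x) m

  iterate-comm : ∀ x m n → iterate f (iterate f x m) n ≡ iterate f (iterate f x n) m
  iterate-comm x m n =
    trans (sym (iterate-+ x m n)) (trans (cong (iterate f x) (+-comm m n)) (iterate-+ x n m))

  iterate-periodic : ∀ {x p} → iterate f x p ≡ x → ∀ q → iterate f x (q * p) ≡ x
  iterate-periodic         per zero    = refl
  iterate-periodic {x} {p} per (suc q) =
    trans (iterate-+ x p (q * p)) (trans (cong (λ y → iterate f y (q * p)) per) (iterate-periodic per q))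

  iterate-along : ∀ {m} (x : Fin (suc m) → A) → (∀ i → x (F.suc i) ≡ f (x (inject₁ i))) →
                  x (fromℕ m) ≡ iterate f (x F.zero) m
  iterate-along {zero}  x _    = refl
  iterate-along {suc m} x succ = trans (succ (fromℕ m))
    (trans (cong f (iterate-along (x ∘ inject₁) (succ ∘ inject₁))) (sym (iterate-suc (x F.zero) m)))

iterate-semiconj : ∀ {A B : Set} {g : A → A} {h : B → B} (F : B → A) → (∀ j → g (F j) ≡ F (h j)) →
                   ∀ j m → iterate g (F j) m ≡ F (iterate h j m)
iterate-semiconj         F commute j zero    = refl
iterate-semiconj {g = g} F commute j (suc m) =
  trans (cong (λ y → iterate g y m) (commute j)) (iterate-semiconj F commute _ m)

indicator : Bool → ℕ
indicator true  = 1
indicator false = 0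

count : {P : ℕ → Set} → Decidable P → ℕ → ℕ → ℕ
count P? s zero    = 0
count P? s (suc m) = indicator (does (P? s)) + count P? (suc s) m

module _ {P : ℕ → Set} (P? : Decidable P) where

  count-++ : ∀ s a c → count P? s (a + c) ≡ count P? s a + count P? (s + a) c
  count-++ s zero    c = cong (λ t → count P? t c) (sym (+-identityʳ s))
  count-++ s (suc a) c = begin
    [s] + count P? (suc s) (a + c)                     ≡⟨ cong ([s] +_) (count-++ (suc s) a c) ⟩
    [s] + (count P? (suc s) a + count P? (suc s + a) c) ≡⟨ sym (+-assoc [s] _ _) ⟩
    [s] + count P? (suc s) a + count P? (suc s + a) c
      ≡⟨ cong (λ t → [s] + count P? (suc s) a + count P? t c) (sym (+-suc s a)) ⟩
    [s] + count P? (suc s) a + count P? (s + suc a) c   ∎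
    where
    open ≡-Reasoning
    [s] = indicator (does (P? s))

  count-snoc : ∀ s m → count P? s (suc m) ≡ count P? s m + indicator (does (P? (s + m)))
  count-snoc s m = trans (cong (count P? s) (+-comm 1 m))
    (trans (count-++ s m 1) (cong (count P? s m +_) (+-identityʳ _)))

  count-none : ∀ s m → (∀ i → i < m → ¬ P (s + i)) → count P? s m ≡ 0
  count-none s zero    _    = refl
  count-none s (suc m) none = cong₂ _+_
    (cong indicator (dec-false (P? s) (subst (¬_ ∘ P) (+-identityʳ s) (none 0 z<s))))
    (count-none (suc s) m λ i i<m → subst (¬_ ∘ P) (+-suc s i) (none (suc i) (s<s i<m)))

module _ {P Q : ℕ → Set} (P? : Decidable P) (Q? : Decidable Q) where

  count-cong : ∀ s t m → (∀ i → i < m → P (s + i) ⇔ Q (t + i)) → count P? s m ≡ count Q? t m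
  count-cong s t zero    _   = refl
  count-cong s t (suc m) P⇔Q = cong₂ _+_
    (cong indicator (does-⇔ (subst₂ _⇔_ (cong P (+-identityʳ s)) (cong Q (+-identityʳ t)) (P⇔Q 0 z<s)) (P? s) (Q? t)))
    (count-cong (suc s) (suc t) m λ i i<m →
      subst₂ _⇔_ (cong P (+-suc s i)) (cong Q (+-suc t i)) (P⇔Q (suc i) (s<s i<m)))

  count-reverse : ∀ s t m → (∀ i → i < m → P (s + i) ⇔ Q (t + (m ∸ suc i))) → count P? s m ≡ count Q? t m
  count-reverse s t zero    _   = refl
  count-reverse s t (suc m) P⇔Q =
    trans (cong₂ _+_ first rest) (trans (+-comm [t+m] (count Q? t m)) (sym (count-snoc Q? t m)))
    where
    [t+m] = indicator (does (Q? (t + m)))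
    first : indicator (does (P? s)) ≡ [t+m]
    first = cong indicator (does-⇔ (subst (_⇔ Q (t + m)) (cong P (+-identityʳ s)) (P⇔Q 0 z<s)) (P? s) (Q? (t + m)))
    rest : count P? (suc s) m ≡ count Q? t m
    rest = count-reverse (suc s) t m λ i i<m →
      subst (_⇔ Q (t + (m ∸ suc i))) (cong P (+-suc s i)) (P⇔Q (suc i) (s<s i<m))

module _ {Q : ℕ → Set} (Q? : Decidable Q) (gap : ℕ → ℕ)
         (miss : ∀ j i → i < gap j → ¬ Q (suc j + i)) (hit : ∀ j → Q (suc j + gap j)) where

  next : ℕ → ℕ
  next j = suc j + gap j

  iterate-next : ∀ i j m → Q (j + m) → count Q? (suc j) m ≡ i → iterate next j i ≡ j + m
  iterate-next zero j zero _ _ = sym (+-identityʳ j)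
  iterate-next zero j (suc m) Q[j+m] none =
    contradiction (m+n≡0⇒n≡0 _ (trans (sym (count-snoc Q? (suc j) m)) none)) last≢0
    where
    last≢0 : indicator (does (Q? (suc j + m))) ≢ 0
    last≢0 rewrite dec-true (Q? (suc j + m)) (subst Q (+-suc j m) Q[j+m]) = λ ()
  iterate-next (suc i) j m Q[j+m] cnt with m ≤? gap j
  ... | yes m≤gap =
    contradiction (trans (sym (count-none Q? (suc j) m λ x x<m → miss j x (<-≤-trans x<m m≤gap))) cnt) λ ()
  ... | no m≰gap with m≤n⇒∃[o]m+o≡n (≰⇒> m≰gap)
  ...   | m′ , refl = trans (iterate-next i (next j) m′ (subst Q j+m≡ Q[j+m]) cnt′) (sym j+m≡)
    where
    j+m≡ : j + (suc (gap j) + m′) ≡ next j + m′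
    j+m≡ = trans (+-suc j (gap j + m′)) (cong suc (sym (+-assoc j (gap j) m′)))
    first-hit : count Q? (suc j) (suc (gap j)) ≡ 1
    first-hit = trans (count-snoc Q? (suc j) (gap j))
      (cong₂ _+_ (count-none Q? (suc j) (gap j) (miss j)) (cong indicator (dec-true (Q? (suc j + gap j)) (hit j))))
    cnt′ : count Q? (suc (next j)) m′ ≡ i
    cnt′ = suc-injective (begin
      suc (count Q? (suc (next j)) m′)
        ≡⟨ cong₂ _+_ (sym first-hit) (cong (λ t → count Q? t m′) (sym (+-suc (suc j) (gap j)))) ⟩
      count Q? (suc j) (suc (gap j)) + count Q? (suc j + suc (gap j)) m′ ≡⟨ sym (count-++ Q? (suc j) (suc (gap j)) m′) ⟩
      count Q? (suc j) (suc (gap j) + m′)                          ≡⟨ cnt ⟩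
      suc i                                                        ∎)
      where open ≡-Reasoning

module _ {A : Set} {P : A → Set} (P? : Decidable P) {Q : ℕ → Set} (Q? : Decidable Q) where

  length-filter-∷ : ∀ x xs → length (filter P? (x ∷ xs)) ≡ indicator (does (P? x)) + length (filter P? xs)
  length-filter-∷ x xs with does (P? x)
  ... | true  = refl
  ... | false = refl

  length-filter-tabulate : ∀ {m} (g : Fin m → A) s → (∀ i → P (g i) ⇔ Q (s + toℕ i)) →
                           length (filter P? (tabulate g)) ≡ count Q? s m
  length-filter-tabulate {zero}  g s P⇔Q = refl
  length-filter-tabulate {suc m} g s P⇔Q = trans (length-filter-∷ (g F.zero) (tabulate (g ∘ F.suc))) (cong₂ _+_
    (cong indicator (does-⇔ (subst (P (g F.zero) ⇔_) (cong Q (+-identityʳ s)) (P⇔Q F.zero)) (P? (g F.zero)) (Q? s)))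
    (length-filter-tabulate (g ∘ F.suc) (suc s) λ i →
      subst (P (g (F.suc i)) ⇔_) (cong Q (+-suc s (toℕ i))) (P⇔Q (F.suc i))))

-- One whirl, element by element

root : ∀ {n k} → Lab n k → ℕ
root f = toℕ (f bot)

leaf : ∀ {n k} → Lab n k → Fin n → ℕ
leaf f i = toℕ (f (b i))

root≤k : ∀ {n k} (f : Lab n k) → root f ≤ k
root≤k f = ≤-pred (toℕ<n (f bot))

leaf≤k : ∀ {n k} (f : Lab n k) i → leaf f i ≤ k
leaf≤k f i = ≤-pred (toℕ<n (f (b i)))

InF-resp : ∀ {n k} {f g : Lab n k} → f ≗ g → InF f → InF g
InF-resp f≗g valid i = subst₂ F._≤_ (f≗g (b i)) (f≗g bot) (valid i)

set-same : ∀ {n k} (f : Lab n k) x v → set f x v x ≡ v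
set-same f bot   v = refl
set-same f (b i) v with i F.≟ i
... | yes _  = refl
... | no i≢i = contradiction refl i≢i

set-other : ∀ {n k} (f : Lab n k) {x y} v → x ≢ y → set f x v y ≡ f y
set-other f {bot}  {bot}  v x≢y = contradiction refl x≢y
set-other f {bot}  {b j}  v _   = refl
set-other f {b i}  {bot}  v _   = refl
set-other f {b i}  {b j}  v x≢y with i F.≟ j
... | yes refl = contradiction refl x≢y
... | no _     = refl

incr-< : ∀ {k} (u : Fin (suc k)) → toℕ u < k → toℕ (incr u) ≡ suc (toℕ u)
incr-< u u<k = trans (toℕ-fromℕ< _) (m<n⇒m%n≡m (s≤s u<k))

incr-max : ∀ {k} (u : Fin (suc k)) → toℕ u ≡ k → toℕ (incr u) ≡ 0
incr-max {k} u u≡k = trans (toℕ-fromℕ< _) (trans (cong (λ m → suc m % suc k) u≡k) (n%n≡0 (suc k)))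

b-injective : ∀ {n} {i j : Fin n} → b i ≡ b j → i ≡ j
b-injective refl = refl

LeafStep : ℕ → ℕ → ℕ → Set
LeafStep c u u′ = (u < c → u′ ≡ suc u) × (u ≡ c → u′ ≡ 0)

module _ {n k : ℕ} where

  whirlAux-frame : ∀ m x (f : Lab n k) {y} → x ≢ y → whirlAux m x f y ≡ f y
  whirlAux-frame zero    x f x≢y = refl
  whirlAux-frame (suc m) x f x≢y with inF? (set f x (incr (f x)))
  ... | yes _ = set-other f _ x≢y
  ... | no _  = trans (whirlAux-frame m x _ x≢y) (set-other f _ x≢y)

  InF-except : Fin n → Lab n k → Set
  InF-except i h = ∀ j → i ≢ j → h (b j) F.≤ h bot

  InF-except-set : ∀ {i} (h : Lab n k) w → InF-except i h → InF-except i (set h (b i) w)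
  InF-except-set h w others j i≢j =
    subst (F._≤ h bot) (sym (set-other h w (i≢j ∘ b-injective))) (others j i≢j)

  set-leaf-valid : ∀ (h : Lab n k) i w → InF-except i h → toℕ w ≤ root h → InF (set h (b i) w)
  set-leaf-valid h i w others w≤c j with i F.≟ j
  ... | yes refl = w≤c
  ... | no i≢j   = others j i≢j

  set-leaf-bound : ∀ (h : Lab n k) i w → InF (set h (b i) w) → toℕ w ≤ root h
  set-leaf-bound h i w valid = subst (λ u → toℕ u ≤ root h) (set-same h (b i) w) (valid i)

  whirlAux-leaf-reset : ∀ m i (h : Lab n k) → InF-except i h → root h ≤ leaf h i → k < leaf h i + m →
                        leaf (whirlAux m (b i) h) i ≡ 0
  whirlAux-leaf-reset zero i h _ _ fuel =
    contradiction (subst (k <_) (+-identityʳ _) fuel) (≤⇒≯ (leaf≤k h i))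
  whirlAux-leaf-reset (suc m) i h others c≤u fuel
    with inF? (set h (b i) (incr (h (b i)))) | m≤n⇒m<n∨m≡n (leaf≤k h i)
  ... | yes valid  | inj₁ u<k =
    contradiction (set-leaf-bound h i _ valid) (<⇒≱ (subst (root h <_) (sym (incr-< _ u<k)) (s≤s c≤u)))
  ... | yes _      | inj₂ u≡k = trans (cong toℕ (set-same h (b i) _)) (incr-max _ u≡k)
  ... | no invalid | inj₂ u≡k =
    contradiction (set-leaf-valid h i _ others (subst (_≤ root h) (sym (incr-max _ u≡k)) z≤n)) invalid
  ... | no _       | inj₁ u<k = whirlAux-leaf-reset m i h′ (InF-except-set h _ others) c≤u′ fuel′
    where
    h′ = set h (b i) (incr (h (b i)))
    u′≡ : leaf h′ i ≡ suc (leaf h i)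
    u′≡ = trans (cong toℕ (set-same h (b i) _)) (incr-< _ u<k)
    c≤u′ : root h′ ≤ leaf h′ i
    c≤u′ = subst (root h ≤_) (sym u′≡) (m≤n⇒m≤1+n c≤u)
    fuel′ : k < leaf h′ i + m
    fuel′ = subst (λ u → k < u + m) (sym u′≡) (subst (k <_) (+-suc _ m) fuel)

  whirlAt-leafStep : ∀ (h : Lab n k) i → InF h → LeafStep (root h) (leaf h i) (leaf (whirlAt (b i) h) i)
  whirlAt-leafStep h i valid = climb , reset
    where
    climb : leaf h i < root h → leaf (whirlAt (b i) h) i ≡ suc (leaf h i)
    climb u<c with inF? (set h (b i) (incr (h (b i))))
    ... | yes _      = trans (cong toℕ (set-same h (b i) _)) (incr-< _ (<-≤-trans u<c (root≤k h)))
    ... | no invalid = contradiction (set-leaf-valid h i _ (λ j _ → valid j)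
                                       (subst (_≤ root h) (sym (incr-< _ (<-≤-trans u<c (root≤k h)))) u<c)) invalid
    reset : leaf h i ≡ root h → leaf (whirlAt (b i) h) i ≡ 0
    reset u≡c = whirlAux-leaf-reset (suc k) i h (λ j _ → valid j) (≤-reflexive (sym u≡c)) (m≤n+m (suc k) _)

  whirlAt-leaf-valid : ∀ (h : Lab n k) i → InF h → InF (whirlAt (b i) h)
  whirlAt-leaf-valid h i valid j with i F.≟ j
  ... | yes refl =
    subst (λ c → leaf (whirlAt (b i) h) i ≤ toℕ c) (sym (whirlAux-frame (suc k) (b i) h λ ())) u′≤c
    where
    u′≤c : leaf (whirlAt (b i) h) i ≤ root h
    u′≤c with m≤n⇒m<n∨m≡n (valid i)
    ... | inj₁ u<c = subst (_≤ root h) (sym (proj₁ (whirlAt-leafStep h i valid) u<c)) u<c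
    ... | inj₂ u≡c = subst (_≤ root h) (sym (proj₂ (whirlAt-leafStep h i valid) u≡c)) z≤n
  ... | no i≢j = subst₂ F._≤_ (sym (whirlAux-frame (suc k) (b i) h (i≢j ∘ b-injective)))
                              (sym (whirlAux-frame (suc k) (b i) h λ ())) (valid j)

  whirlAt-root-climb : ∀ (h : Lab n k) → InF h → root h < k →
                       InF (whirlAt bot h) × root (whirlAt bot h) ≡ suc (root h)
  whirlAt-root-climb h valid c<k with inF? (set h bot (incr (h bot)))
  ... | yes valid′ = valid′ , incr-< _ c<k
  ... | no invalid = contradiction (λ i → subst (leaf h i ≤_) (sym (incr-< _ c<k)) (m≤n⇒m≤1+n (valid i))) invalid

  whirlAux-root-search : ∀ m (h : Lab n k) j → root h < leaf h j → k ≤ root h + m →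
                         InF (whirlAux m bot h) × ∃ λ i → leaf (whirlAux m bot h) i ≡ root (whirlAux m bot h)
  whirlAux-root-search zero h j c<u fuel =
    contradiction (≤-trans fuel (≤-reflexive (+-identityʳ _))) (<⇒≱ (<-≤-trans c<u (leaf≤k h j)))
  whirlAux-root-search (suc m) h j c<u fuel with inF? (set h bot (incr (h bot)))
  ... | yes valid = valid , j , ≤-antisym (valid j) (subst (_≤ leaf h j) (sym c′≡) c<u)
    where
    c′≡ : toℕ (incr (h bot)) ≡ suc (root h)
    c′≡ = incr-< _ (<-≤-trans c<u (leaf≤k h j))
  ... | no invalid with ¬∀⟶∃¬ n _ (λ i → h (b i) F.≤? incr (h bot)) invalid
  ...   | j′ , u≰c′ = whirlAux-root-search m (set h bot (incr (h bot))) j′ (≰⇒> u≰c′) fuel′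
    where
    fuel′ : k ≤ toℕ (incr (h bot)) + m
    fuel′ = subst (λ c → k ≤ c + m) (sym (incr-< _ (<-≤-trans c<u (leaf≤k h j))))
                  (subst (k ≤_) (+-suc _ m) fuel)

  whirlAt-root-wrap : ∀ (h : Lab n k) → Fin n → root h ≡ k →
                      InF (whirlAt bot h) × ∃ λ i → leaf (whirlAt bot h) i ≡ root (whirlAt bot h)
  whirlAt-root-wrap h i₀ c≡k with inF? (set h bot (incr (h bot)))
  ... | yes valid = valid , i₀ , trans (n≤0⇒n≡0 (subst (leaf h i₀ ≤_) c′≡0 (valid i₀))) (sym c′≡0)
    where
    c′≡0 : toℕ (incr (h bot)) ≡ 0
    c′≡0 = incr-max _ c≡k
  ... | no invalid with ¬∀⟶∃¬ n _ (λ i → h (b i) F.≤? incr (h bot)) invalid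
  ...   | j , u≰c′ = whirlAux-root-search k (set h bot (incr (h bot))) j (≰⇒> u≰c′) (m≤n+m k _)

  whirlLeaves : List (Fin n) → Lab n k → Lab n k
  whirlLeaves is f = foldl (λ g i → whirlAt (b i) g) f is

  record LeavesWhirled (is : List (Fin n)) (f g : Lab n k) : Set where
    field
      valid      : InF g
      root-fixed : g bot ≡ f bot
      stepped    : ∀ {j} → j ∈ is → LeafStep (root f) (leaf f j) (leaf g j)
      untouched  : ∀ {j} → j ∉ is → g (b j) ≡ f (b j)

  whirlLeaves-spec : ∀ is (f : Lab n k) → InF f → Unique is → LeavesWhirled is f (whirlLeaves is f)
  whirlLeaves-spec [] f valid [] = record
    { valid = valid ; root-fixed = refl ; stepped = λ () ; untouched = λ _ → refl }
  whirlLeaves-spec (i ∷ is) f valid (i≢is ∷ unique) = record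
    { valid      = ih.valid
    ; root-fixed = trans ih.root-fixed (frame λ ())
    ; stepped    = stepped
    ; untouched  = λ j∉ → trans (ih.untouched (j∉ ∘ there)) (frame (λ eq → j∉ (here (sym (b-injective eq)))))
    }
    where
    h = whirlAt (b i) f
    frame : ∀ {y} → b i ≢ y → h y ≡ f y
    frame = whirlAux-frame (suc k) (b i) f
    module ih = LeavesWhirled (whirlLeaves-spec is h (whirlAt-leaf-valid f i valid) unique)
    stepped : ∀ {j} → j ∈ i ∷ is → LeafStep (root f) (leaf f j) (leaf (whirlLeaves is h) j)
    stepped (here refl)  = subst (LeafStep (root f) (leaf f i)) (cong toℕ (sym (ih.untouched i∉is)))
                                 (whirlAt-leafStep f i valid)
      where
      i∉is : i ∉ is
      i∉is i∈is = All.lookup i≢is i∈is refl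
    stepped {j} (there j∈is) = subst₂ (λ c u → LeafStep c u (leaf (whirlLeaves is h) j)) (cong toℕ (frame λ ()))
                                  (cong toℕ (frame (All.lookup i≢is j∈is ∘ b-injective))) (ih.stepped j∈is)

record IsWhirlStep {n k} (f g : Lab n k) : Set where
  field
    source-valid : InF f
    target-valid : InF g
    leaf-step    : ∀ i → LeafStep (root f) (leaf f i) (leaf g i)
    root-climb   : root f < k → root g ≡ suc (root f)
    root-wrap    : root f ≡ k → ∃ λ i → leaf g i ≡ root g

whirl-isWhirlStep : ∀ {n k} → Fin n → (f : Lab n k) → InF f → IsWhirlStep f (whirl f)
whirl-isWhirlStep {n} {k} i₀ f valid = record
  { source-valid = valid
  ; target-valid = target-valid
  ; leaf-step    = λ i → subst (LeafStep (root f) (leaf f i)) (cong toℕ (sym (frame i)))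
                                 (L.stepped (∈-allFin i))
  ; root-climb   = λ c<k → trans (proj₂ (climb c<k)) (cong suc root-fixed)
  ; root-wrap    = proj₂ ∘ wrap
  }
  where
  g = whirlLeaves (allFin n) f
  module L = LeavesWhirled (whirlLeaves-spec (allFin n) f valid (allFin⁺ n))
  root-fixed : root g ≡ root f
  root-fixed = cong toℕ L.root-fixed
  frame : ∀ i → whirl f (b i) ≡ g (b i)
  frame i = whirlAux-frame (suc k) bot g λ ()
  climb : root f < k → InF (whirl f) × root (whirl f) ≡ suc (root g)
  climb c<k = whirlAt-root-climb g L.valid (subst (_< k) (sym root-fixed) c<k)
  wrap : root f ≡ k → InF (whirl f) × ∃ λ i → leaf (whirl f) i ≡ root (whirl f)
  wrap c≡k = whirlAt-root-wrap g i₀ (trans root-fixed c≡k)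
  target-valid : InF (whirl f)
  target-valid with m≤n⇒m<n∨m≡n (root≤k f)
  ... | inj₁ c<k = proj₁ (climb c<k)
  ... | inj₂ c≡k = proj₁ (wrap c≡k)

IsWhirlStep-resp : ∀ {n k} {f g g′ : Lab n k} → g ≗ g′ → IsWhirlStep f g → IsWhirlStep f g′
IsWhirlStep-resp {g = g} {g′} g≗g′ step = record
  { source-valid = source-valid
  ; target-valid = InF-resp g≗g′ target-valid
  ; leaf-step    = λ i → subst (LeafStep _ _) (leaf≡ i) (leaf-step i)
  ; root-climb   = λ c<k → trans (sym root≡) (root-climb c<k)
  ; root-wrap    = λ c≡k → let (i , eq) = root-wrap c≡k in i , trans (sym (leaf≡ i)) (trans eq root≡)
  }
  where
  open IsWhirlStep step
  root≡ : root g ≡ root g′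
  root≡ = cong toℕ (g≗g′ bot)
  leaf≡ : ∀ i → leaf g i ≡ leaf g′ i
  leaf≡ i = cong toℕ (g≗g′ (b i))

-- Occupied positions

module _ {n k : ℕ} where

  LeafAt : Lab n k → ℕ → Set
  LeafAt f e = ∃ λ i → leaf f i ≡ e

  leafAt? : ∀ f → Decidable (LeafAt f)
  leafAt? f e = F.any? λ i → leaf f i ≟ e

  Occupied : Lab n k → ℕ → Set
  Occupied f e = e ≡ root f ⊎ (e < root f × LeafAt f e) ⊎ (e ≡ suc k × LeafAt f (root f))

  occupied? : ∀ f → Decidable (Occupied f)
  occupied? f e = e ≟ root f ⊎-dec ((e <? root f) ×-dec leafAt? f e) ⊎-dec ((e ≟ suc k) ×-dec leafAt? f (root f))

  occupancy : Lab n k → ℕ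
  occupancy f = count (occupied? f) 0 (2 + k)

  Peak : Lab n k → Set
  Peak f = root f ≡ k

  occupied⇒≤root : ∀ f {e} → Occupied f e → e ≤ k → e ≤ root f
  occupied⇒≤root f (inj₁ e≡c)               _   = ≤-reflexive e≡c
  occupied⇒≤root f (inj₂ (inj₁ (e<c , _)))  _   = <⇒≤ e<c
  occupied⇒≤root f (inj₂ (inj₂ (e≡1+k , _))) e≤k = contradiction (subst (_≤ k) e≡1+k e≤k) (<-irrefl refl)

  peak⇔occupied : ∀ f → Peak f ⇔ Occupied f k
  peak⇔occupied f =
    mk⇔ (λ c≡k → inj₁ (sym c≡k)) (λ occ → ≤-antisym (root≤k f) (occupied⇒≤root f occ ≤-refl))

  α≡count : ∀ f → α f ≡ count (leafAt? f) 0 (suc k)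
  α≡count f = length-filter-tabulate (λ v → F.any? (λ j → f (b j) F.≟ v)) (leafAt? f) (λ v → v) 0
    λ v → mk⇔ (λ (i , eq) → i , cong toℕ eq) (λ (i , eq) → i , toℕ-injective eq)

  not-occupied-above-root : ∀ f {x} → root f < x → x ≤ k → ¬ Occupied f x
  not-occupied-above-root f c<x x≤k (inj₁ x≡c)               = <-irrefl (sym x≡c) c<x
  not-occupied-above-root f c<x x≤k (inj₂ (inj₁ (x<c , _)))  = <-asym c<x x<c
  not-occupied-above-root f c<x x≤k (inj₂ (inj₂ (x≡1+k , _))) = <-irrefl refl (subst (_≤ k) x≡1+k x≤k)

  occupied-below-root : ∀ f {x} → x < root f → Occupied f x ⇔ LeafAt f x
  occupied-below-root f x<c = mk⇔ to (λ leafAt → inj₂ (inj₁ (x<c , leafAt)))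
    where
    to : Occupied f _ → LeafAt f _
    to (inj₁ x≡c)                = contradiction x≡c (<⇒≢ x<c)
    to (inj₂ (inj₁ (_ , leafAt))) = leafAt
    to (inj₂ (inj₂ (x≡1+k , _)))  =
      contradiction (≤-trans (<⇒≤ (subst (_< root f) x≡1+k x<c)) (root≤k f)) (<-irrefl refl)

  occupied-1+k : ∀ f → Occupied f (suc k) ⇔ LeafAt f (root f)
  occupied-1+k f = mk⇔ to (λ leafAt → inj₂ (inj₂ (refl , leafAt)))
    where
    to : Occupied f (suc k) → LeafAt f (root f)
    to (inj₁ 1+k≡c)               = contradiction (root≤k f) (<⇒≱ (≤-reflexive 1+k≡c))
    to (inj₂ (inj₁ (1+k<c , _)))  = contradiction (root≤k f) (<⇒≱ (<-trans (n<1+n k) 1+k<c))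
    to (inj₂ (inj₂ (_ , leafAt))) = leafAt

  root+gap : ∀ (f : Lab n k) m → root f + (m + (k ∸ root f)) ≡ m + k
  root+gap f m = trans (x∙yz≈y∙xz (root f) m _) (cong (m +_) (m+[n∸m]≡n (root≤k f)))

  count-leafAt-split : ∀ f → InF f →
    count (leafAt? f) 0 (suc k) ≡ count (leafAt? f) 0 (root f) + indicator (does (leafAt? f (root f)))
  count-leafAt-split f valid = begin
    count leaves 0 (suc k)                                ≡⟨ cong (count leaves 0) (sym (root+gap f 1)) ⟩
    count leaves 0 (c + suc d)                            ≡⟨ count-++ leaves 0 c (suc d) ⟩
    count leaves 0 c + ([c] + count leaves (suc c) d)     ≡⟨ cong (λ x → count leaves 0 c + ([c] + x)) none-above ⟩
    count leaves 0 c + ([c] + 0)                          ≡⟨ cong (count leaves 0 c +_) (+-identityʳ [c]) ⟩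
    count leaves 0 c + [c]                                ∎
    where
    open ≡-Reasoning
    c = root f
    d = k ∸ c
    leaves = leafAt? f
    [c] = indicator (does (leaves c))
    none-above : count leaves (suc c) d ≡ 0
    none-above = count-none leaves (suc c) d λ i _ (j , u≡x) →
      <⇒≱ (s≤s (m≤m+n c i)) (subst (_≤ c) u≡x (valid j))

  occupancy-split : ∀ f → occupancy f ≡ suc (count (leafAt? f) 0 (root f) + indicator (does (leafAt? f (root f))))
  occupancy-split f = begin
    count occ 0 (2 + k)                                                    ≡⟨ cong (count occ 0) (sym (root+gap f 2)) ⟩
    count occ 0 (c + (2 + d))                                              ≡⟨ count-++ occ 0 c (2 + d) ⟩
    count occ 0 c + (indicator (does (occ c)) + count occ (suc c) (suc d))
      ≡⟨ cong₂ (λ x y → x + (indicator (does (occ c)) + y)) below (count-snoc occ (suc c) d) ⟩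
    count leaves 0 c + (indicator (does (occ c)) + (count occ (suc c) d + indicator (does (occ (suc c + d)))))
      ≡⟨ cong₂ (λ x y → count leaves 0 c + (x + y)) root-occupied (cong₂ _+_ none-above at-1+k) ⟩
    count leaves 0 c + suc (indicator (does (leaves c)))                   ≡⟨ +-suc _ _ ⟩
    suc (count leaves 0 c + indicator (does (leaves c)))                   ∎
    where
    open ≡-Reasoning
    c = root f
    d = k ∸ c
    occ = occupied? f
    leaves = leafAt? f
    below : count occ 0 c ≡ count leaves 0 c
    below = count-cong occ leaves 0 0 c λ i i<c → occupied-below-root f i<c
    root-occupied : indicator (does (occ c)) ≡ 1
    root-occupied = cong indicator (dec-true (occ c) (inj₁ refl))
    none-above : count occ (suc c) d ≡ 0
    none-above = count-none occ (suc c) d λ i i<d → not-occupied-above-root f (s≤s (m≤m+n c i))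
      (subst (suc c + i ≤_) (m+[n∸m]≡n (root≤k f)) (subst (_≤ c + d) (+-suc c i) (+-monoʳ-≤ c i<d)))
    at-1+k : indicator (does (occ (suc c + d))) ≡ indicator (does (leaves c))
    at-1+k = cong indicator (does-⇔ (subst (λ x → Occupied f x ⇔ LeafAt f c) (cong suc (sym (m+[n∸m]≡n (root≤k f))))
                                            (occupied-1+k f)) (occ (suc c + d)) (leaves c))

  occupancy-valid : ∀ f → InF f → occupancy f ≡ suc (α f)
  occupancy-valid f valid = trans (occupancy-split f) (cong suc (sym (trans (α≡count f) (count-leafAt-split f valid))))

module _ {n k : ℕ} {f g : Lab n k} (step : IsWhirlStep f g) where
  open IsWhirlStep step

  private
    root-cases : root f < k ⊎ root f ≡ k
    root-cases = m≤n⇒m<n∨m≡n (root≤k f)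

  leaf-step-suc⁻¹ : ∀ {i e} → leaf g i ≡ suc e → leaf f i ≡ e × e < root f
  leaf-step-suc⁻¹ {i} u′≡1+e with m≤n⇒m<n∨m≡n (source-valid i)
  ... | inj₁ u<c = let u≡e = suc-injective (trans (sym (proj₁ (leaf-step i) u<c)) u′≡1+e)
                   in u≡e , subst (_< root f) u≡e u<c
  ... | inj₂ u≡c = contradiction (trans (sym u′≡1+e) (proj₂ (leaf-step i) u≡c)) λ ()

  leaf-step-zero⁻¹ : ∀ {i} → leaf g i ≡ 0 → leaf f i ≡ root f
  leaf-step-zero⁻¹ {i} u′≡0 with m≤n⇒m<n∨m≡n (source-valid i)
  ... | inj₁ u<c = contradiction (trans (sym (proj₁ (leaf-step i) u<c)) u′≡0) λ ()
  ... | inj₂ u≡c = u≡c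

  occupied-step-suc : ∀ {e} → e ≤ k → Occupied g (suc e) ⇔ Occupied f e
  occupied-step-suc {e} e≤k = mk⇔ to from
    where
    to : Occupied g (suc e) → Occupied f e
    to (inj₁ 1+e≡c′) with root-cases
    ... | inj₁ c<k = inj₁ (suc-injective (trans 1+e≡c′ (root-climb c<k)))
    ... | inj₂ c≡k = let (i , u′≡c′) = root-wrap c≡k
                         (u≡e , e<c) = leaf-step-suc⁻¹ (trans u′≡c′ (sym 1+e≡c′))
                     in inj₂ (inj₁ (e<c , i , u≡e))
    to (inj₂ (inj₁ (_ , i , u′≡1+e))) =
      let (u≡e , e<c) = leaf-step-suc⁻¹ u′≡1+e in inj₂ (inj₁ (e<c , i , u≡e))
    to (inj₂ (inj₂ (1+e≡1+k , i , u′≡c′))) with root-cases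
    ... | inj₁ c<k = contradiction (proj₂ (leaf-step-suc⁻¹ (trans u′≡c′ (root-climb c<k)))) (<-irrefl refl)
    ... | inj₂ c≡k = inj₁ (trans (suc-injective 1+e≡1+k) (sym c≡k))
    from : Occupied f e → Occupied g (suc e)
    from (inj₁ e≡c) with root-cases
    ... | inj₁ c<k = inj₁ (trans (cong suc e≡c) (sym (root-climb c<k)))
    ... | inj₂ c≡k = inj₂ (inj₂ (cong suc (trans e≡c c≡k) , root-wrap c≡k))
    from (inj₂ (inj₁ (e<c , i , u≡e))) with m≤n⇒m<n∨m≡n (target-valid i)
    ... | inj₁ u′<c′ = inj₂ (inj₁ (subst (_< root g) u′≡1+e u′<c′ , i , u′≡1+e))
      where u′≡1+e = trans (proj₁ (leaf-step i) (subst (_< root f) (sym u≡e) e<c)) (cong suc u≡e)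
    ... | inj₂ u′≡c′ = inj₁ (trans (sym u′≡1+e) u′≡c′)
      where u′≡1+e = trans (proj₁ (leaf-step i) (subst (_< root f) (sym u≡e) e<c)) (cong suc u≡e)
    from (inj₂ (inj₂ (e≡1+k , _))) = contradiction (subst (_≤ k) e≡1+k e≤k) (<-irrefl refl)

  occupied-step-zero : Occupied g 0 ⇔ Occupied f (suc k)
  occupied-step-zero = mk⇔ to from
    where
    to : Occupied g 0 → Occupied f (suc k)
    to (inj₁ 0≡c′) with root-cases
    ... | inj₁ c<k = contradiction (trans 0≡c′ (root-climb c<k)) λ ()
    ... | inj₂ c≡k =
      let (i , u′≡c′) = root-wrap c≡k in inj₂ (inj₂ (refl , i , leaf-step-zero⁻¹ (trans u′≡c′ (sym 0≡c′))))
    to (inj₂ (inj₁ (_ , i , u′≡0))) = inj₂ (inj₂ (refl , i , leaf-step-zero⁻¹ u′≡0))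
    from : Occupied f (suc k) → Occupied g 0
    from occ with Equivalence.to (occupied-1+k f) occ
    ... | i , u≡c with m≤n⇒m<n∨m≡n (z≤n {root g})
    ...   | inj₁ 0<c′ = inj₂ (inj₁ (0<c′ , i , proj₂ (leaf-step i) u≡c))
    ...   | inj₂ 0≡c′ = inj₁ 0≡c′

  occupancy-step : occupancy g ≡ occupancy f
  occupancy-step = begin
    indicator (does (occupied? g 0)) + count (occupied? g) 1 (suc k)
      ≡⟨ cong₂ _+_ (cong indicator (does-⇔ occupied-step-zero (occupied? g 0) (occupied? f (suc k))))
                   (count-cong (occupied? g) (occupied? f) 1 0 (suc k) λ i i<1+k → occupied-step-suc (≤-pred i<1+k)) ⟩
    indicator (does (occupied? f (suc k))) + count (occupied? f) 0 (suc k)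
      ≡⟨ +-comm (indicator (does (occupied? f (suc k)))) _ ⟩
    count (occupied? f) 0 (suc k) + indicator (does (occupied? f (suc k)))
      ≡⟨ sym (count-snoc (occupied? f) 0 (suc k)) ⟩
    occupancy f ∎
    where open ≡-Reasoning

  α-step : α g ≡ α f
  α-step = suc-injective (trans (sym (occupancy-valid g target-valid))
                                (trans occupancy-step (occupancy-valid f source-valid)))

module _ {n k : ℕ} (i₀ : Fin n) where

  wpow-valid : ∀ t {f : Lab n k} → InF f → InF (wpow t f)
  wpow-valid zero    valid = valid
  wpow-valid (suc t) valid = IsWhirlStep.target-valid (whirl-isWhirlStep i₀ _ (wpow-valid t valid))

  α-wpow : ∀ t {f : Lab n k} → InF f → α (wpow t f) ≡ α f
  α-wpow zero    valid = refl
  α-wpow (suc t) valid = trans (α-step (whirl-isWhirlStep i₀ _ (wpow-valid t valid))) (α-wpow t valid)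

-- Trajectories

module Trajectory {n k : ℕ} (L : ℕ → Lab n k) (step : ∀ j → IsWhirlStep (L j) (L (suc j))) where

  occupied-≡ : ∀ {t t′ x x′} → t ≡ t′ → x ≡ x′ → Occupied (L t) x ⇔ Occupied (L t′) x′
  occupied-≡ refl refl = ⇔.refl

  occupied-shift : ∀ m j {e} → m + e ≤ suc k → Occupied (L (m + j)) (m + e) ⇔ Occupied (L j) e
  occupied-shift zero    j _       = ⇔.refl
  occupied-shift (suc m) j m+e<1+k = ⇔.trans (occupied-step-suc (step (m + j)) (≤-pred m+e<1+k))
                                             (occupied-shift m j (m≤n⇒m≤1+n (≤-pred m+e<1+k)))

  occupied-periodic : ∀ j {e} → e ≤ suc k → Occupied (L ((2 + k) + j)) e ⇔ Occupied (L j) e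
  -- Position e climbs to k+1 in d steps, wraps around to 0, and is back at e after e more.
  occupied-periodic j {e} e≤1+k =
    ⇔.trans (occupied-≡ (sym time≡) (sym (+-identityʳ e)))
    (⇔.trans (occupied-shift e (suc (d + j)) (subst (_≤ suc k) (sym (+-identityʳ e)) e≤1+k))
    (⇔.trans (occupied-step-zero (step (d + j)))
    (⇔.trans (occupied-≡ refl (sym d+e≡1+k))
             (occupied-shift d j (≤-reflexive d+e≡1+k)))))
    where
    d = suc k ∸ e
    d+e≡1+k : d + e ≡ suc k
    d+e≡1+k = m∸n+n≡m e≤1+k
    time≡ : e + suc (d + j) ≡ (2 + k) + j
    time≡ = trans (+-suc e (d + j)) (cong suc (trans (sym (+-assoc e d j)) (cong (_+ j) (trans (+-comm e d) d+e≡1+k))))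

  root-periodic : ∀ j → root (L ((2 + k) + j)) ≡ root (L j)
  root-periodic j = ≤-antisym
    (occupied⇒≤root (L j) (Equivalence.to (occupied-periodic j (bound later)) (inj₁ refl)) (root≤k later))
    (occupied⇒≤root later (Equivalence.from (occupied-periodic j (bound (L j))) (inj₁ refl)) (root≤k (L j)))
    where
    later = L ((2 + k) + j)
    bound : ∀ f → root f ≤ suc k
    bound f = m≤n⇒m≤1+n (root≤k f)

  root-periodic-∣ : ∀ {d} → (2 + k) ∣ d → ∀ j → root (L (d + j)) ≡ root (L j)
  root-periodic-∣ (divides q refl) = go q
    where
    go : ∀ q j → root (L (q * (2 + k) + j)) ≡ root (L j)
    go zero    j = refl
    go (suc q) j = trans (cong (root ∘ L) (+-assoc (2 + k) (q * (2 + k)) j)) (trans (root-periodic _) (go q j))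

  root-run : ∀ m j → m + root (L j) ≤ k → root (L (m + j)) ≡ m + root (L j)
  root-run zero    j _     = refl
  root-run (suc m) j fits = trans (IsWhirlStep.root-climb (step (m + j)) (subst (_< k) (sym ih) fits)) (cong suc ih)
    where
    ih : root (L (m + j)) ≡ m + root (L j)
    ih = root-run m j (<⇒≤ fits)

  peak? : Decidable (Peak ∘ L)
  peak? j = root (L j) ≟ k

  peaks-per-period : ∀ j → count peak? j (2 + k) ≡ occupancy (L j)
  peaks-per-period j = begin
    count peak? j (2 + k)                                              ≡⟨ count-snoc peak? j (suc k) ⟩
    count peak? j (suc k) + indicator (does (peak? (j + suc k)))
      ≡⟨ cong₂ _+_ (count-reverse peak? (occupied? (L j)) j 0 (suc k) λ i i<1+k → within i (≤-pred i<1+k))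
                   (cong indicator (does-⇔ wrap (peak? (j + suc k)) (occupied? (L j) (suc k)))) ⟩
    count (occupied? (L j)) 0 (suc k) + indicator (does (occupied? (L j) (suc k)))
                                                                       ≡⟨ sym (count-snoc (occupied? (L j)) 0 (suc k)) ⟩
    occupancy (L j)                                                    ∎
    where
    open ≡-Reasoning
    within : ∀ i → i ≤ k → Peak (L (j + i)) ⇔ Occupied (L j) (k ∸ i)
    within i i≤k = ⇔.trans (peak⇔occupied (L (j + i)))
      (⇔.trans (occupied-≡ (+-comm j i) (sym (m+[n∸m]≡n i≤k)))
               (occupied-shift i j (m≤n⇒m≤1+n (≤-reflexive (m+[n∸m]≡n i≤k)))))
    wrap : Peak (L (j + suc k)) ⇔ Occupied (L j) (suc k)
    wrap = ⇔.trans (peak⇔occupied (L (j + suc k)))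
      (⇔.trans (occupied-≡ (trans (+-comm j (suc k)) (sym (+-suc k j))) (sym (+-identityʳ k)))
      (⇔.trans (occupied-shift k (suc j) (m≤n⇒m≤1+n (≤-reflexive (+-identityʳ k))))
               (occupied-step-zero (step j))))

  gap : ℕ → ℕ
  gap j = k ∸ root (L (suc j))

  private
    run-after : ∀ j i → i ≤ gap j → root (L (suc j + i)) ≡ i + root (L (suc j))
    run-after j i i≤gap = trans (cong (root ∘ L) (+-comm (suc j) i))
      (root-run i (suc j) (subst (i + root (L (suc j)) ≤_) (m∸n+n≡m (root≤k (L (suc j)))) (+-monoˡ-≤ _ i≤gap)))

    miss : ∀ j i → i < gap j → ¬ Peak (L (suc j + i))
    miss j i i<gap peak = <-irrefl (trans (sym (run-after j i (<⇒≤ i<gap))) peak)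
      (subst (i + root (L (suc j)) <_) (m∸n+n≡m (root≤k (L (suc j)))) (+-monoˡ-< _ i<gap))

    hit : ∀ j → Peak (L (suc j + gap j))
    hit j = trans (run-after j (gap j) ≤-refl) (m∸n+n≡m (root≤k (L (suc j))))

  nextPeak : ℕ → ℕ
  nextPeak = next peak? gap miss hit

  nextPeak-period : ∀ j → Peak (L j) → iterate nextPeak j (occupancy (L (suc j))) ≡ j + (2 + k)
  nextPeak-period j peak = iterate-next peak? gap miss hit (occupancy (L (suc j))) j (2 + k)
    (trans (cong (root ∘ L) (+-comm j (2 + k))) (trans (root-periodic j) peak)) (peaks-per-period (suc j))

-- Whorms on the orbit board

module _ {n k : ℕ} (f₀ : Lab n k) (N : ℕ) .{{_ : NonZero N}} where
  open Board f₀ N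

  toℕ-iterate-nextT : ∀ t j → toℕ (iterate nextT t j) ≡ (toℕ t + j) % N
  toℕ-iterate-nextT t zero    = sym (trans (cong (_% N) (+-identityʳ _)) (m<n⇒m%n≡m (toℕ<n t)))
  toℕ-iterate-nextT t (suc j) = trans (toℕ-iterate-nextT (nextT t) j) (begin
    (toℕ (nextT t) + j) % N              ≡⟨ cong (λ x → (x + j) % N) (toℕ-fromℕ< _) ⟩
    (suc (toℕ t) % N + j) % N            ≡⟨ %-distribˡ-+ (suc (toℕ t) % N) j N ⟩
    (suc (toℕ t) % N % N + j % N) % N    ≡⟨ cong (λ x → (x + j % N) % N) (m%n%n≡m%n (suc (toℕ t)) N) ⟩
    (suc (toℕ t) % N + j % N) % N        ≡⟨ sym (%-distribˡ-+ (suc (toℕ t)) j N) ⟩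
    (suc (toℕ t) + j) % N                ≡⟨ cong (_% N) (sym (+-suc (toℕ t) j)) ⟩
    (toℕ t + suc j) % N                  ∎)
    where open ≡-Reasoning

  iterate-nextT-N : ∀ t → iterate nextT t N ≡ t
  iterate-nextT-N t = toℕ-injective
    (trans (toℕ-iterate-nextT t N) (trans ([m+n]%n≡m%n (toℕ t) N) (m<n⇒m%n≡m (toℕ<n t))))

  iterate-nextT-period : ∀ t d → iterate nextT (iterate nextT t d) (pred N * d) ≡ t
  iterate-nextT-period t d = begin
    iterate nextT (iterate nextT t d) (pred N * d) ≡⟨ sym (iterate-+ nextT t d (pred N * d)) ⟩
    iterate nextT t (suc (pred N) * d)            ≡⟨ cong (λ m → iterate nextT t (m * d)) (suc-pred N) ⟩
    iterate nextT t (N * d)                        ≡⟨ cong (iterate nextT t) (*-comm N d) ⟩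
    iterate nextT t (d * N)                        ≡⟨ iterate-periodic nextT (iterate-nextT-N t) d ⟩
    t                                              ∎
    where open ≡-Reasoning

module Whorms {n k : ℕ} (f₀ : Lab n k) (valid₀ : InF f₀) (i₀ : Fin n)
              (N : ℕ) .{{_ : NonZero N}} (periodic : wpow N f₀ ≗ f₀) where
  open Board f₀ N

  row-valid : ∀ t → InF (row t)
  row-valid t = wpow-valid i₀ (toℕ t) valid₀

  row-nextT : ∀ t → row (nextT t) ≗ whirl (row t)
  row-nextT t y with m≤n⇒m<n∨m≡n (toℕ<n t)
  ... | inj₁ 1+t<N = cong (λ m → wpow m f₀ y) (trans (toℕ-fromℕ< _) (m<n⇒m%n≡m 1+t<N))
  ... | inj₂ 1+t≡N = begin
    wpow (toℕ (nextT t)) f₀ y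
      ≡⟨ cong (λ m → wpow m f₀ y) (trans (toℕ-fromℕ< _) (trans (cong (_% N) 1+t≡N) (n%n≡0 N))) ⟩
    f₀ y                        ≡⟨ sym (periodic y) ⟩
    wpow N f₀ y                 ≡⟨ cong (λ m → wpow m f₀ y) (sym 1+t≡N) ⟩
    whirl (row t) y             ∎
    where open ≡-Reasoning

  row-step : ∀ t → IsWhirlStep (row t) (row (nextT t))
  row-step t = IsWhirlStep-resp (sym ∘ row-nextT t) (whirl-isWhirlStep i₀ (row t) (row-valid t))

  orbit : Fin N → ℕ → Lab n k
  orbit t j = row (iterate nextT t j)

  orbit-step : ∀ t j → IsWhirlStep (orbit t j) (orbit t (suc j))
  orbit-step t j =
    subst (IsWhirlStep (orbit t j) ∘ row) (sym (iterate-suc nextT t j)) (row-step (iterate nextT t j))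

  module OrbitFrom (t : Fin N) = Trajectory (orbit t) (orbit-step t)

  -- The row in which the label of x, rising by one per row from row t, reaches k.
  summit : WE → Fin N
  summit (x , t) = iterate nextT t (k ∸ toℕ (row t x))

  summit-WSucc : ∀ {e e′} → WSucc e e′ → summit e ≡ summit e′
  summit-WSucc {x , t} (inj₁ (refl , refl , u′≡1+u)) = cong (iterate nextT t) (trans
    (+-∸-assoc 1 (subst (_≤ k) u′≡1+u (≤-pred (toℕ<n (row (nextT t) x)))))
    (cong (λ u′ → suc (k ∸ u′)) (sym u′≡1+u)))
  summit-WSucc {x , t} (inj₂ (cov i , refl , u≡c)) = cong (λ v → iterate nextT t (k ∸ toℕ v)) u≡c

  summit-whorm : ∀ {e e′} → SameWhorm e e′ → summit e ≡ summit e′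
  summit-whorm = EqClosure.gfold isEquivalence summit summit-WSucc

  summit-peak : ∀ {t} → Peak (row t) → summit (bot , t) ≡ t
  summit-peak {t} peak =
    trans (cong (λ c → iterate nextT t (k ∸ c)) peak) (cong (iterate nextT t) (n∸n≡0 k))

  climb : ∀ t → SameWhorm (bot , t) (bot , summit (bot , t))
  climb t = climb-by _ t refl
    where
    climb-by : ∀ d t → k ∸ root (row t) ≡ d → SameWhorm (bot , t) (bot , iterate nextT t d)
    climb-by zero    t _     = ε
    climb-by (suc d) t gap≡ =
      fwd (inj₁ (refl , refl , IsWhirlStep.root-climb (row-step t) c<k)) ◅ climb-by d (nextT t) gap′
      where
      c<k : root (row t) < k
      c<k = m∸n≢0⇒n<m (λ gap≡0 → contradiction (trans (sym gap≡) gap≡0) λ ())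
      gap′ : k ∸ root (row (nextT t)) ≡ d
      gap′ = suc-injective (begin
        suc (k ∸ root (row (nextT t))) ≡⟨ cong (λ c → suc (k ∸ c)) (IsWhirlStep.root-climb (row-step t) c<k) ⟩
        suc (k ∸ suc (root (row t)))   ≡⟨ sym (+-∸-assoc 1 c<k) ⟩
        k ∸ root (row t)               ≡⟨ gap≡ ⟩
        suc d                          ∎)
        where open ≡-Reasoning

  same-summit⇒same-whorm : ∀ {t t′} → summit (bot , t) ≡ summit (bot , t′) →
                           SameWhorm (bot , t) (bot , t′)
  same-summit⇒same-whorm {t} {t′} eq = EqClosure.transitive WSucc (climb t)
    (subst (λ s → SameWhorm (bot , s) (bot , t′)) (sym eq) (EqClosure.symmetric WSucc (climb t′)))

  nextSummit : Fin N → Fin N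
  nextSummit t = summit (bot , nextT t)

  inFront-summit : ∀ {e e′} → InFront e e′ → Peak (row (summit e)) × summit e′ ≡ nextSummit (summit e)
  inFront-summit (t , e∼t , peak , e′∼t′) =
    subst (Peak ∘ row) (sym summit≡t) peak , trans (summit-whorm e′∼t′) (cong nextSummit (sym summit≡t))
    where
    summit≡t = trans (summit-whorm e∼t) (summit-peak peak)

  nextSummit-orbit : ∀ t j → nextSummit (iterate nextT t j) ≡ iterate nextT t (OrbitFrom.nextPeak t j)
  nextSummit-orbit t j =
    trans (cong (λ s → iterate nextT s (k ∸ root (row s))) (sym (iterate-suc nextT t j)))
          (sym (iterate-+ nextT t (suc j) _))

  summits-per-period : ∀ t → Peak (row t) → iterate nextSummit t (suc (α f₀)) ≡ iterate nextT t (2 + k)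
  summits-per-period t peak = begin
    iterate nextSummit t (suc (α f₀))
      ≡⟨ iterate-semiconj (iterate nextT t) (nextSummit-orbit t) 0 (suc (α f₀)) ⟩
    iterate nextT t (iterate (OrbitFrom.nextPeak t) 0 (suc (α f₀)))
      ≡⟨ cong (iterate nextT t ∘ iterate (OrbitFrom.nextPeak t) 0) (sym occupancy≡) ⟩
    iterate nextT t (iterate (OrbitFrom.nextPeak t) 0 (occupancy (row (nextT t))))
      ≡⟨ cong (iterate nextT t) (OrbitFrom.nextPeak-period t 0 peak) ⟩
    iterate nextT t (2 + k)                                   ∎
    where
    open ≡-Reasoning
    occupancy≡ : occupancy (row (nextT t)) ≡ suc (α f₀)
    occupancy≡ = trans (occupancy-valid (row (nextT t)) (row-valid (nextT t)))
                       (cong suc (α-wpow i₀ (toℕ (nextT t)) valid₀))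

  IsT-shift-≤ : ∀ {d e e′ τ τ′} → (2 + k) ∣ d → IsT e τ → IsT e′ τ′ →
                summit e′ ≡ iterate nextT (summit e) d → τ′ ≤ τ
  IsT-shift-≤ {d} {e} {e′} {τ} {τ′} period∣d ((r , e∼r , τ≡) , _) ((r′ , e′∼r′ , _) , minimal′) shifted =
    subst (τ′ ≤_) (trans (cong suc root≡) τ≡) (minimal′ σr e′∼σr)
    where
    σr = iterate nextT r d
    root≡ : root (row σr) ≡ root (row r)
    root≡ = trans (cong (root ∘ orbit r) (sym (+-identityʳ d))) (OrbitFrom.root-periodic-∣ r period∣d 0)
    summit-σr : summit (bot , σr) ≡ summit e′
    summit-σr = begin
      iterate nextT σr (k ∸ root (row σr))                 ≡⟨ cong (λ c → iterate nextT σr (k ∸ c)) root≡ ⟩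
      iterate nextT σr (k ∸ root (row r))                  ≡⟨ iterate-comm nextT r d (k ∸ root (row r)) ⟩
      iterate nextT (summit (bot , r)) d                   ≡⟨ cong (λ s → iterate nextT s d) (sym (summit-whorm e∼r)) ⟩
      iterate nextT (summit e) d                           ≡⟨ sym shifted ⟩
      summit e′                                            ∎
      where open ≡-Reasoning
    e′∼σr : SameWhorm e′ (bot , σr)
    e′∼σr = EqClosure.transitive WSucc e′∼r′
      (same-summit⇒same-whorm (trans (sym (summit-whorm e′∼r′)) (sym summit-σr)))

corollary4p7 : (n k : ℕ) → 1 ≤ n → 1 ≤ k →
    (f₀ : Lab n k) → InF f₀ →
    (N : ℕ) .{{_ : NonZero N}} → IsOrbitSize f₀ N →
    (ξ : Fin (2 + α f₀) → Board.WE f₀ N) →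
    (∀ (i : Fin (1 + α f₀)) → Board.InFront f₀ N (ξ (inject₁ i)) (ξ (Fin.suc i))) →
    ∀ τ₁ τ₂ → Board.IsT f₀ N (ξ Fin.zero) τ₁ → Board.IsT f₀ N (ξ (fromℕ (1 + α f₀))) τ₂ →
    τ₁ ≡ τ₂
corollary4p7 n k 1≤n _ f₀ valid₀ N (periodic , _) ξ inFront τ₁ τ₂ isT₁ isT₂ =
  ≤-antisym (IsT-shift-≤ (n∣m*n (pred N)) isT₂ isT₁ first≡) (IsT-shift-≤ ∣-refl isT₁ isT₂ last≡)
  where
  open Board f₀ N
  open Whorms f₀ valid₀ (F.fromℕ< 1≤n) N periodic
  T₀ = summit (ξ F.zero)
  last≡ : summit (ξ (fromℕ (1 + α f₀))) ≡ iterate nextT T₀ (2 + k)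
  last≡ = trans (iterate-along nextSummit (summit ∘ ξ) (λ i → proj₂ (inFront-summit (inFront i))))
                (summits-per-period T₀ (proj₁ (inFront-summit (inFront F.zero))))
  first≡ : T₀ ≡ iterate nextT (summit (ξ (fromℕ (1 + α f₀)))) (pred N * (2 + k))
  first≡ = sym (trans (cong (λ s → iterate nextT s (pred N * (2 + k))) last≡)
                      (iterate-nextT-period f₀ N T₀ (2 + k)))
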